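{- Let $G$ be a group with monoid presentation $\mathrm{mon}\langle X_G, R_G\rangle$, and let $\theta : X_G^* \to G$ be the natural monoid homomorphism. Let $X_H, X_K \subseteq X_G^*$ be such that $\theta(X_H)$ generates a subgroup $H\le G$ and $\theta(X_K)$ generates a subgroup $K \le G$. Let $H,K$ also denote two new symbols not in $X_G$, let $T_+ = (\{H,K\}\cup X_G)^*$ be the free monoid, and let $T = \{HwK : w \in X_G^*\}\subseteq T_+$. Define $$R = R_G \cup \{(Hh, H) : h \in X_H\} \cup \{(kK, K) : k \in X_K\},$$ let $\to_R$ be the reduction relation generated by $R$ on $T_+$, and let $\stackrel{*}{\leftrightarrow}_R$ be its reflexive, symmetric, transitive closure (the congruence on $T_+$ generated by $R$). Then there is a bijection of sets $$T/\!\stackrel{*}{\leftrightarrow}_R \;\cong\; G/\!\sim,$$ where $g\sim g'$ iff $hgk = g'$ for some $h\in H$, $k \in K$.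
   Context: For a group $G$ and subgroups $H,K$, the double cosets are the equivalence classes of the relation $g\sim g' \iff hgk=g'$ for some $h\in H, k\in K$; the set of double cosets is $H\backslash G/K = G/\!\sim$. A rewriting system $R\subseteq T_+\times T_+$ generates the reduction relation $\to_R$ given by $ulv \to_R urv$ for $(l,r)\in R$, $u,v\in T_+$. -}

module Defs where

open import Level using (0ℓ)
open import Data.List using (List; []; _∷_; _++_; map; foldr)
open import Data.Product using (Σ; ∃; _×_; _,_)
open import Function.Bundles using (_⇔_)
open import Relation.Binary.Core using (Rel)
open import Relation.Binary.Construct.Closure.Equivalence using (EqClosure)
open import Algebra.Bundles using (Group)

data Step {B : Set} (R : Rel (List B) 0ℓ) : Rel (List B) 0ℓ where
  step : ∀ (u l r v : List B) → R l r → Step R (u ++ l ++ v) (u ++ r ++ v)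

Congr : {B : Set} → Rel (List B) 0ℓ → Rel (List B) 0ℓ
Congr R = EqClosure (Step R)

module _ (G : Group 0ℓ 0ℓ) where
  open Group G

  θ : {A : Set} → (A → Carrier) → List A → Carrier
  θ φ = foldr (λ a g → φ a ∙ g) ε

  IsMonPresentation : (A : Set) → (A → Carrier) → Rel (List A) 0ℓ → Set
  IsMonPresentation A φ RG =
    (∀ g → ∃ λ w → θ φ w ≈ g) ×
    (∀ u v → (θ φ u ≈ θ φ v) ⇔ Congr RG u v)

  data InSubgroup (S : Carrier → Set) : Carrier → Set where
    gen  : ∀ {g} → S g → InSubgroup S g
    unit : InSubgroup S ε
    mul  : ∀ {g h} → InSubgroup S g → InSubgroup S h → InSubgroup S (g ∙ h)
    inv  : ∀ {g} → InSubgroup S g → InSubgroup S (g ⁻¹)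
    resp : ∀ {g h} → g ≈ h → InSubgroup S g → InSubgroup S h

  Image : {A : Set} → (A → Carrier) → (List A → Set) → Carrier → Set
  Image φ Xs g = ∃ λ w → Xs w × θ φ w ≈ g

  DoubleCosetRel : (Carrier → Set) → (Carrier → Set) → Rel Carrier 0ℓ
  DoubleCosetRel H K g g' =
    ∃ λ h → ∃ λ k → H h × K k × (h ∙ g ∙ k ≈ g')

data Letter (A : Set) : Set where
  symH : Letter A
  symK : Letter A
  sym  : A → Letter A

data RSys {A : Set} (RG : Rel (List A) 0ℓ) (XH XK : List A → Set)
          : Rel (List (Letter A)) 0ℓ where
  ruleG : ∀ {l r} → RG l r → RSys RG XH XK (map sym l) (map sym r)
  ruleH : ∀ {h} → XH h → RSys RG XH XK (symH ∷ map sym h) (symH ∷ [])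
  ruleK : ∀ {k} → XK k → RSys RG XH XK (map sym k ++ symK ∷ []) (symK ∷ [])

toT : {A : Set} → List A → List (Letter A)
toT w = symH ∷ map sym w ++ symK ∷ []

-- Words of T₊ act on subsets of G from the right: a letter of X_G multiplies by its
-- image under φ, the letters H and K multiply by the subgroups H and K.  Every rule
-- of R preserves this action (the rules of R_G because they hold in G, the rules
-- Hh → H and kK → K because θ h ∈ H and θ k ∈ K), and H w K sends {ε} to the double
-- coset H θ(w) K; so ↔*_R-equivalent words of T have the same double coset.
-- Conversely every element of H is the value of a word u with H ↔*_R H u (and
-- similarly for K), built along the generation of H; together with the presentation
-- this turns h θ(w) k = θ(w′) into H w K ↔*_R H w′ K.
module Submission where

open import Defs
open import Level using (0ℓ) renaming (suc to lsuc)
open import Data.List using (List; []; _∷_; _++_; map; foldl)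
open import Data.List.Properties using (++-assoc; ++-identityʳ; map-++; foldl-++)
open import Data.Product using (∃; ∃₂; _×_; _,_; proj₁; proj₂)
open import Function.Bundles using (Equivalence)
open import Relation.Unary using (Pred; _⊆_; _≐_)
open import Relation.Unary.Properties using (≐-refl; ≐-sym; ≐-trans)
open import Relation.Unary.Relation.Binary.Equality using (≐-setoid)
open import Relation.Binary.Core using (Rel)
open import Relation.Binary.Definitions using (_Respects_)
open import Relation.Binary.Structures using (IsEquivalence)
open import Relation.Binary.PropositionalEquality as ≡ using (_≡_; cong; subst₂)
open import Relation.Binary.Construct.Closure.ReflexiveTransitive using (_◅◅_)
import Relation.Binary.Construct.Closure.Equivalence as EC
import Relation.Binary.Reasoning.Setoid as SetoidReasoning
open import Algebra.Bundles using (Group)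

module _ {B : Set} {R : Rel (List B) 0ℓ} where

  Step-++ˡ : ∀ p {a b} → Step R a b → Step R (p ++ a) (p ++ b)
  Step-++ˡ p (step u l r v x) =
    subst₂ (Step R) (++-assoc p u (l ++ v)) (++-assoc p u (r ++ v)) (step (p ++ u) l r v x)

  Step-++ʳ : ∀ q {a b} → Step R a b → Step R (a ++ q) (b ++ q)
  Step-++ʳ q (step u l r v x) = subst₂ (Step R) (reassoc l) (reassoc r) (step u l r (v ++ q) x)
    where
    reassoc : ∀ m → u ++ m ++ v ++ q ≡ (u ++ m ++ v) ++ q
    reassoc m = ≡.sym (≡.trans (++-assoc u (m ++ v) q) (cong (u ++_) (++-assoc m v q)))

  Congr-++ˡ : ∀ p {a b} → Congr R a b → Congr R (p ++ a) (p ++ b)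
  Congr-++ˡ p = EC.gmap (p ++_) (Step-++ˡ p)

  Congr-++ʳ : ∀ q {a b} → Congr R a b → Congr R (a ++ q) (b ++ q)
  Congr-++ʳ q = EC.gmap (_++ q) (Step-++ʳ q)

  Congr-++ : ∀ {a b c d} → Congr R a b → Congr R c d → Congr R (a ++ c) (b ++ d)
  Congr-++ {b = b} {c = c} a↔b c↔d = Congr-++ʳ c a↔b ◅◅ Congr-++ˡ b c↔d

  rule⇒Congr : ∀ {l r} → R l r → Congr R l r
  rule⇒Congr {l} {r} x =
    EC.return (subst₂ (Step R) (++-identityʳ l) (++-identityʳ r) (step [] l r [] x))

Congr-map : ∀ {B C : Set} {R : Rel (List B) 0ℓ} {S : Rel (List C) 0ℓ} (f : B → C) →
            (∀ {l r} → R l r → S (map f l) (map f r)) →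
            ∀ {a b} → Congr R a b → Congr S (map f a) (map f b)
Congr-map {S = S} f rule = EC.gmap (map f) step-map
  where
  step-map : ∀ {a b} → Step _ a b → Step S (map f a) (map f b)
  step-map (step u l r v x) =
    subst₂ (Step S) (map-++-++ l) (map-++-++ r) (step (map f u) (map f l) (map f r) (map f v) (rule x))
    where
    map-++-++ : ∀ m → map f u ++ map f m ++ map f v ≡ map f (u ++ m ++ v)
    map-++-++ m = ≡.sym (≡.trans (map-++ f u (m ++ v)) (cong (map f u ++_) (map-++ f m v)))

map-++-assoc : ∀ {B C : Set} (f : B → C) u v q → map f (u ++ v) ++ q ≡ map f u ++ map f v ++ q
map-++-assoc f u v q = ≡.trans (cong (_++ q) (map-++ f u v)) (++-assoc (map f u) (map f v) q)

module SubsetProducts (G : Group 0ℓ 0ℓ) where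
  open Group G renaming (sym to ≈-sym; refl to ≈-refl; trans to ≈-trans)
  open import Algebra.Properties.Group G using (//-rightDividesˡ; \\-leftDividesˡ)

  Subset : Set₁
  Subset = Pred Carrier 0ℓ

  infixl 7 _⋆_
  _⋆_ : Subset → Subset → Subset
  (P ⋆ Q) x = ∃₂ λ p q → P p × Q q × x ≈ p ∙ q

  ｛_｝ : Carrier → Subset
  ｛ g ｝ x = x ≈ g

  ⋆-resp-≈ : ∀ {P Q} → (P ⋆ Q) Respects _≈_
  ⋆-resp-≈ x≈y (p , q , Pp , Qq , x≈pq) = p , q , Pp , Qq , ≈-trans (≈-sym x≈y) x≈pq

  ⋆-monoˡ : ∀ {P P′ Q} → P ⊆ P′ → P ⋆ Q ⊆ P′ ⋆ Q
  ⋆-monoˡ P⊆P′ (p , q , Pp , Qq , x≈pq) = p , q , P⊆P′ Pp , Qq , x≈pq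

  ⋆-monoʳ : ∀ {P Q Q′} → Q ⊆ Q′ → P ⋆ Q ⊆ P ⋆ Q′
  ⋆-monoʳ Q⊆Q′ (p , q , Pp , Qq , x≈pq) = p , q , Pp , Q⊆Q′ Qq , x≈pq

  ⋆-congˡ : ∀ {P P′ Q} → P ≐ P′ → P ⋆ Q ≐ P′ ⋆ Q
  ⋆-congˡ (P⊆P′ , P′⊆P) = ⋆-monoˡ P⊆P′ , ⋆-monoˡ P′⊆P

  ⋆-congʳ : ∀ {P Q Q′} → Q ≐ Q′ → P ⋆ Q ≐ P ⋆ Q′
  ⋆-congʳ (Q⊆Q′ , Q′⊆Q) = ⋆-monoʳ Q⊆Q′ , ⋆-monoʳ Q′⊆Q

  ⋆-assoc : ∀ P Q S → (P ⋆ Q) ⋆ S ≐ P ⋆ (Q ⋆ S)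
  ⋆-assoc P Q S = to , from
    where
    to : (P ⋆ Q) ⋆ S ⊆ P ⋆ (Q ⋆ S)
    to (y , s , (p , q , Pp , Qq , y≈pq) , Ss , x≈ys) =
      p , q ∙ s , Pp , (q , s , Qq , Ss , ≈-refl) ,
      ≈-trans x≈ys (≈-trans (∙-congʳ y≈pq) (assoc p q s))
    from : P ⋆ (Q ⋆ S) ⊆ (P ⋆ Q) ⋆ S
    from (p , y , Pp , (q , s , Qq , Ss , y≈qs) , x≈py) =
      p ∙ q , s , (p , q , Pp , Qq , ≈-refl) , Ss ,
      ≈-trans x≈py (≈-trans (∙-congˡ y≈qs) (≈-sym (assoc p q s)))

  ⋆-identityʳ : ∀ {P} → P Respects _≈_ → P ⋆ ｛ ε ｝ ≐ P
  ⋆-identityʳ {P} P-resp = to , from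
    where
    to : P ⋆ ｛ ε ｝ ⊆ P
    to (p , e , Pp , e≈ε , x≈pe) = P-resp (≈-sym (≈-trans x≈pe (≈-trans (∙-congˡ e≈ε) (identityʳ p)))) Pp
    from : P ⊆ P ⋆ ｛ ε ｝
    from {x} Px = x , ε , Px , ≈-refl , ≈-sym (identityʳ x)

  ｛｝-cong : ∀ {g h} → g ≈ h → ｛ g ｝ ≐ ｛ h ｝
  ｛｝-cong g≈h = (λ x≈g → ≈-trans x≈g g≈h) , (λ x≈h → ≈-trans x≈h (≈-sym g≈h))

  ｛｝-⋆-｛｝ : ∀ g h → ｛ g ｝ ⋆ ｛ h ｝ ≐ ｛ g ∙ h ｝
  ｛｝-⋆-｛｝ g h =
    (λ (p , q , p≈g , q≈h , x≈pq) → ≈-trans x≈pq (∙-cong p≈g q≈h)) ,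
    (λ x≈gh → g , h , ≈-refl , ≈-refl , x≈gh)

  module _ {S : Carrier → Set} {g : Carrier} (g∈S : InSubgroup G S g) where

    subgroup-⋆-｛｝ : InSubgroup G S ⋆ ｛ g ｝ ≐ InSubgroup G S
    subgroup-⋆-｛｝ =
      (λ (h , s , h∈S , s≈g , x≈hs) → resp (≈-sym (≈-trans x≈hs (∙-congˡ s≈g))) (mul h∈S g∈S)) ,
      (λ {x} x∈S → x // g , g , mul x∈S (inv g∈S) , ≈-refl , ≈-sym (//-rightDividesˡ g x))

    ｛｝-⋆-subgroup : ｛ g ｝ ⋆ InSubgroup G S ≐ InSubgroup G S
    ｛｝-⋆-subgroup =
      (λ (s , k , s≈g , k∈S , x≈sk) → resp (≈-sym (≈-trans x≈sk (∙-congʳ s≈g))) (mul g∈S k∈S)) ,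
      (λ {x} x∈S → g , g \\ x , ≈-refl , mul (inv g∈S) x∈S , ≈-sym (\\-leftDividesˡ g x))

  double-coset : ∀ H K g → (H ⋆ ｛ g ｝) ⋆ K ≐ DoubleCosetRel G H K g
  double-coset H K g = to , from
    where
    to : (H ⋆ ｛ g ｝) ⋆ K ⊆ DoubleCosetRel G H K g
    to (y , k , (h , s , h∈H , s≈g , y≈hs) , k∈K , x≈yk) =
      h , k , h∈H , k∈K , ≈-sym (≈-trans x≈yk (∙-congʳ (≈-trans y≈hs (∙-congˡ s≈g))))
    from : DoubleCosetRel G H K g ⊆ (H ⋆ ｛ g ｝) ⋆ K
    from (h , k , h∈H , k∈K , hgk≈x) = h ∙ g , k , (h , g , h∈H , ≈-refl , ≈-refl) , k∈K , ≈-sym hgk≈x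

  ∼-reflexive : ∀ {S T g g′} → g ≈ g′ → DoubleCosetRel G (InSubgroup G S) (InSubgroup G T) g g′
  ∼-reflexive {g = g} g≈g′ = ε , ε , unit , unit , ≈-trans (identityʳ (ε ∙ g)) (≈-trans (identityˡ g) g≈g′)

  θ-++ : ∀ {A : Set} (φ : A → Carrier) u v → θ G φ (u ++ v) ≈ θ G φ u ∙ θ G φ v
  θ-++ φ [] v = ≈-sym (identityˡ (θ G φ v))
  θ-++ φ (a ∷ u) v = ≈-trans (∙-congˡ (θ-++ φ u v)) (≈-sym (assoc (φ a) (θ G φ u) (θ G φ v)))

module DoubleCosetPresentation (G : Group 0ℓ 0ℓ) (A : Set) (φ : A → Group.Carrier G)
    (RG : Rel (List A) 0ℓ) (pres : IsMonPresentation G A φ RG) (XH XK : List A → Set) where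
  open Group G renaming (sym to ≈-sym; refl to ≈-refl; trans to ≈-trans)
  open SubsetProducts G

  H K : Subset
  H = InSubgroup G (Image G φ XH)
  K = InSubgroup G (Image G φ XK)

  _∼_ : Rel Carrier 0ℓ
  _∼_ = DoubleCosetRel G H K

  RS : Rel (List (Letter A)) 0ℓ
  RS = RSys RG XH XK

  θφ : List A → Carrier
  θφ = θ G φ

  Congr⇒θ≈ : ∀ {u v} → Congr RG u v → θφ u ≈ θφ v
  Congr⇒θ≈ {u} {v} = Equivalence.from (proj₂ pres u v)

  θ≈⇒Congr : ∀ {u v} → θφ u ≈ θφ v → Congr RS (map sym u) (map sym v)
  θ≈⇒Congr {u} {v} e = Congr-map sym ruleG (Equivalence.to (proj₂ pres u v) e)

  ⟦_⟧ : Letter A → Subset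
  ⟦ symH ⟧  = H
  ⟦ symK ⟧  = K
  ⟦ sym a ⟧ = ｛ φ a ｝

  infixl 7 _◃_
  _◃_ : Subset → List (Letter A) → Subset
  P ◃ w = foldl (λ Q x → Q ⋆ ⟦ x ⟧) P w

  ◃-++ : ∀ P u v → P ◃ (u ++ v) ≡ P ◃ u ◃ v
  ◃-++ = foldl-++ (λ Q x → Q ⋆ ⟦ x ⟧)

  ◃-cong : ∀ {P P′} w → P ≐ P′ → P ◃ w ≐ P′ ◃ w
  ◃-cong []      P≐P′ = P≐P′
  ◃-cong (x ∷ w) P≐P′ = ◃-cong w (⋆-congˡ P≐P′)

  ◃-resp-≈ : ∀ {P} w → P Respects _≈_ → (P ◃ w) Respects _≈_
  ◃-resp-≈ []      P-resp = P-resp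
  ◃-resp-≈ (x ∷ w) P-resp = ◃-resp-≈ w ⋆-resp-≈

  ◃-word : ∀ {P} u → P Respects _≈_ → P ◃ map sym u ≐ P ⋆ ｛ θφ u ｝
  ◃-word []      P-resp = ≐-sym (⋆-identityʳ P-resp)
  ◃-word {P} (a ∷ u) P-resp = begin
    P ⋆ ｛ φ a ｝ ◃ map sym u      ≈⟨ ◃-word u ⋆-resp-≈ ⟩
    P ⋆ ｛ φ a ｝ ⋆ ｛ θφ u ｝      ≈⟨ ⋆-assoc P _ _ ⟩
    P ⋆ (｛ φ a ｝ ⋆ ｛ θφ u ｝)    ≈⟨ ⋆-congʳ (｛｝-⋆-｛｝ (φ a) (θφ u)) ⟩
    P ⋆ ｛ φ a ∙ θφ u ｝           ∎
    where open SetoidReasoning (≐-setoid Carrier 0ℓ)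

  _≋_ : Rel (List (Letter A)) (lsuc 0ℓ)
  a ≋ b = ∀ P → P Respects _≈_ → P ◃ a ≐ P ◃ b

  ≋-isEquivalence : IsEquivalence _≋_
  ≋-isEquivalence = record
    { refl  = λ P P-resp → ≐-refl
    ; sym   = λ a≋b P P-resp → ≐-sym (a≋b P P-resp)
    ; trans = λ a≋b b≋c P P-resp → ≐-trans (a≋b P P-resp) (b≋c P P-resp)
    }

  rule⇒≋ : ∀ {l r} → RS l r → l ≋ r
  rule⇒≋ (ruleG {l} {r} l→r) P P-resp = begin
    P ◃ map sym l     ≈⟨ ◃-word l P-resp ⟩
    P ⋆ ｛ θφ l ｝    ≈⟨ ⋆-congʳ (｛｝-cong (Congr⇒θ≈ (rule⇒Congr l→r))) ⟩
    P ⋆ ｛ θφ r ｝    ≈⟨ ◃-word r P-resp ⟨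
    P ◃ map sym r     ∎
    where open SetoidReasoning (≐-setoid Carrier 0ℓ)
  rule⇒≋ (ruleH {h} h∈XH) P P-resp = begin
    P ⋆ H ◃ map sym h    ≈⟨ ◃-word h ⋆-resp-≈ ⟩
    P ⋆ H ⋆ ｛ θφ h ｝   ≈⟨ ⋆-assoc P H _ ⟩
    P ⋆ (H ⋆ ｛ θφ h ｝) ≈⟨ ⋆-congʳ (subgroup-⋆-｛｝ (gen (h , h∈XH , ≈-refl))) ⟩
    P ⋆ H                ∎
    where open SetoidReasoning (≐-setoid Carrier 0ℓ)
  rule⇒≋ (ruleK {k} k∈XK) P P-resp = begin
    P ◃ (map sym k ++ symK ∷ [])  ≡⟨ ◃-++ P (map sym k) (symK ∷ []) ⟩
    P ◃ map sym k ⋆ K             ≈⟨ ⋆-congˡ (◃-word k P-resp) ⟩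
    P ⋆ ｛ θφ k ｝ ⋆ K            ≈⟨ ⋆-assoc P _ K ⟩
    P ⋆ (｛ θφ k ｝ ⋆ K)          ≈⟨ ⋆-congʳ (｛｝-⋆-subgroup (gen (k , k∈XK , ≈-refl))) ⟩
    P ⋆ K                         ∎
    where open SetoidReasoning (≐-setoid Carrier 0ℓ)

  step⇒≋ : ∀ {a b} → Step RS a b → a ≋ b
  step⇒≋ (step u l r v l→r) P P-resp
    rewrite ◃-++ P u (l ++ v) | ◃-++ P u (r ++ v) | ◃-++ (P ◃ u) l v | ◃-++ (P ◃ u) r v
    = ◃-cong v (rule⇒≋ l→r (P ◃ u) (◃-resp-≈ u P-resp))

  Congr⇒≋ : ∀ {a b} → Congr RS a b → a ≋ b
  Congr⇒≋ = EC.fold ≋-isEquivalence step⇒≋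

  ｛ε｝◃toT : ∀ w → ｛ ε ｝ ◃ toT w ≐ DoubleCosetRel G H K (θφ w)
  ｛ε｝◃toT w = begin
    ｛ ε ｝ ⋆ H ◃ (map sym w ++ symK ∷ [])  ≡⟨ ◃-++ (｛ ε ｝ ⋆ H) (map sym w) (symK ∷ []) ⟩
    ｛ ε ｝ ⋆ H ◃ map sym w ⋆ K             ≈⟨ ⋆-congˡ (◃-word w ⋆-resp-≈) ⟩
    ｛ ε ｝ ⋆ H ⋆ ｛ θφ w ｝ ⋆ K            ≈⟨ ⋆-congˡ (⋆-congˡ (｛｝-⋆-subgroup unit)) ⟩
    H ⋆ ｛ θφ w ｝ ⋆ K                      ≈⟨ double-coset H K (θφ w) ⟩
    DoubleCosetRel G H K (θφ w)             ∎
    where open SetoidReasoning (≐-setoid Carrier 0ℓ)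

  sound : ∀ w w′ → Congr RS (toT w) (toT w′) → θφ w ∼ θφ w′
  sound w w′ T↔T′ = proj₁ (｛ε｝◃toT w) (proj₂ (Congr⇒≋ T↔T′ ｛ ε ｝ ｛ε｝-resp) θw′∈｛ε｝◃T′)
    where
    ｛ε｝-resp : ｛ ε ｝ Respects _≈_
    ｛ε｝-resp x≈y x≈ε = ≈-trans (≈-sym x≈y) x≈ε
    θw′∈｛ε｝◃T′ : (｛ ε ｝ ◃ toT w′) (θφ w′)
    θw′∈｛ε｝◃T′ = proj₂ (｛ε｝◃toT w′) (∼-reflexive ≈-refl)

  H-absorbs : ∀ {g} → H g → ∃ λ u → θφ u ≈ g × Congr RS (symH ∷ []) (symH ∷ map sym u)
  H-absorbs (gen (w , w∈XH , θw≈g)) = w , θw≈g , EC.symmetric (Step RS) (rule⇒Congr (ruleH w∈XH))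
  H-absorbs unit = [] , ≈-refl , EC.reflexive (Step RS)
  H-absorbs (mul g∈H g′∈H) with H-absorbs g∈H | H-absorbs g′∈H
  ... | u , θu≈g , Hu | u′ , θu′≈g′ , Hu′ = u ++ u′ , ≈-trans (θ-++ φ u u′) (∙-cong θu≈g θu′≈g′) ,
    (begin
      symH ∷ []                          ≈⟨ Hu′ ⟩
      symH ∷ map sym u′                  ≈⟨ Congr-++ʳ (map sym u′) Hu ⟩
      symH ∷ map sym u ++ map sym u′     ≡⟨ cong (symH ∷_) (map-++ sym u u′) ⟨
      symH ∷ map sym (u ++ u′)           ∎)
    where open SetoidReasoning (EC.setoid (Step RS))
  H-absorbs (inv {g} g∈H) with H-absorbs g∈H | proj₁ pres (g ⁻¹)
  ... | u , θu≈g , Hu | v , θv≈g⁻¹ = v , θv≈g⁻¹ ,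
    (begin
      symH ∷ []                          ≈⟨ Congr-++ˡ (symH ∷ []) (θ≈⇒Congr θuv≈ε) ⟨
      symH ∷ map sym (u ++ v)            ≡⟨ cong (symH ∷_) (map-++ sym u v) ⟩
      symH ∷ map sym u ++ map sym v      ≈⟨ Congr-++ʳ (map sym v) Hu ⟨
      symH ∷ map sym v                   ∎)
    where
    open SetoidReasoning (EC.setoid (Step RS))
    θuv≈ε : θφ (u ++ v) ≈ ε
    θuv≈ε = ≈-trans (θ-++ φ u v) (≈-trans (∙-cong θu≈g θv≈g⁻¹) (inverseʳ g))
  H-absorbs (resp g≈g′ g∈H) with H-absorbs g∈H
  ... | u , θu≈g , Hu = u , ≈-trans θu≈g g≈g′ , Hu

  K-absorbs : ∀ {g} → K g → ∃ λ u → θφ u ≈ g × Congr RS (symK ∷ []) (map sym u ++ symK ∷ [])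
  K-absorbs (gen (w , w∈XK , θw≈g)) = w , θw≈g , EC.symmetric (Step RS) (rule⇒Congr (ruleK w∈XK))
  K-absorbs unit = [] , ≈-refl , EC.reflexive (Step RS)
  K-absorbs (mul g∈K g′∈K) with K-absorbs g∈K | K-absorbs g′∈K
  ... | u , θu≈g , Ku | u′ , θu′≈g′ , Ku′ = u ++ u′ , ≈-trans (θ-++ φ u u′) (∙-cong θu≈g θu′≈g′) ,
    (begin
      symK ∷ []                              ≈⟨ Ku ⟩
      map sym u ++ symK ∷ []                 ≈⟨ Congr-++ˡ (map sym u) Ku′ ⟩
      map sym u ++ map sym u′ ++ symK ∷ []   ≡⟨ map-++-assoc sym u u′ (symK ∷ []) ⟨
      map sym (u ++ u′) ++ symK ∷ []         ∎)
    where open SetoidReasoning (EC.setoid (Step RS))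
  K-absorbs (inv {g} g∈K) with K-absorbs g∈K | proj₁ pres (g ⁻¹)
  ... | u , θu≈g , Ku | v , θv≈g⁻¹ = v , θv≈g⁻¹ ,
    (begin
      symK ∷ []                              ≈⟨ Congr-++ʳ (symK ∷ []) (θ≈⇒Congr {v = []} θvu≈ε) ⟨
      map sym (v ++ u) ++ symK ∷ []          ≡⟨ map-++-assoc sym v u (symK ∷ []) ⟩
      map sym v ++ map sym u ++ symK ∷ []    ≈⟨ Congr-++ˡ (map sym v) Ku ⟨
      map sym v ++ symK ∷ []                 ∎)
    where
    open SetoidReasoning (EC.setoid (Step RS))
    θvu≈ε : θφ (v ++ u) ≈ ε
    θvu≈ε = ≈-trans (θ-++ φ v u) (≈-trans (∙-cong θv≈g⁻¹ θu≈g) (inverseˡ g))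
  K-absorbs (resp g≈g′ g∈K) with K-absorbs g∈K
  ... | u , θu≈g , Ku = u , ≈-trans θu≈g g≈g′ , Ku

  complete : ∀ w w′ → θφ w ∼ θφ w′ → Congr RS (toT w) (toT w′)
  complete w w′ (h , k , h∈H , k∈K , hθwk≈θw′) with H-absorbs h∈H | K-absorbs k∈K
  ... | u , θu≈h , Hu | v , θv≈k , Kv = begin
    symH ∷ map sym w ++ [K]                              ≈⟨ Congr-++ Hu (Congr-++ˡ (map sym w) Kv) ⟩
    symH ∷ map sym u ++ map sym w ++ map sym v ++ [K]    ≡⟨ cong (symH ∷_) reassoc ⟨
    symH ∷ map sym (u ++ w ++ v) ++ [K]                  ≈⟨ Congr-++ˡ (symH ∷ []) (Congr-++ʳ [K] (θ≈⇒Congr θuwv≈θw′)) ⟩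
    symH ∷ map sym w′ ++ [K]                             ∎
    where
    open SetoidReasoning (EC.setoid (Step RS))
    [K] : List (Letter A)
    [K] = symK ∷ []
    reassoc : map sym (u ++ w ++ v) ++ [K] ≡ map sym u ++ map sym w ++ map sym v ++ [K]
    reassoc = ≡.trans (map-++-assoc sym u (w ++ v) [K]) (cong (map sym u ++_) (map-++-assoc sym w v [K]))
    θuwv≈θw′ : θφ (u ++ w ++ v) ≈ θφ w′
    θuwv≈θw′ = ≈-trans (θ-++ φ u (w ++ v)) (≈-trans (∙-cong θu≈h (θ-++ φ w v))
               (≈-trans (∙-congˡ (∙-congˡ θv≈k)) (≈-trans (≈-sym (assoc h (θφ w) k)) hθwk≈θw′)))

  surjective : ∀ g → ∃ λ w → θφ w ∼ g
  surjective g with proj₁ pres g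
  ... | w , θw≈g = w , ∼-reflexive θw≈g

mainTheorem1 : (G : Group 0ℓ 0ℓ) (A : Set) (φ : A → Group.Carrier G)
    (RG : Rel (List A) 0ℓ) → IsMonPresentation G A φ RG →
    (XH XK : List A → Set) →
    let H = InSubgroup G (Image G φ XH)
        K = InSubgroup G (Image G φ XK)
        _∼_ = DoubleCosetRel G H K
        _≈T_ = λ (w w′ : List A) → Congr (RSys RG XH XK) (toT w) (toT w′)
    in ∃ λ (f : List A → Group.Carrier G) →
         (∀ w w′ → w ≈T w′ → f w ∼ f w′) ×
         (∀ w w′ → f w ∼ f w′ → w ≈T w′) ×
         (∀ g → ∃ λ w → f w ∼ g)
mainTheorem1 G A φ RG pres XH XK = θ G φ , sound , complete , surjective
  where open DoubleCosetPresentation G A φ RG pres XH XK
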